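{- Let $t$ be a positive integer, let $M$ be a matroid with the $(t,2t)$-property, and let $(S_1,\dots,S_n)$ be a $t$-echidna of $M$ with $n \ge 3t-1$. Let $I$ be a $(t-1)$-element subset of $\{1,\dots,n\}$. Then for every $z\in E(M)-\bigcup_{i\in I}S_i$, there is a $2t$-element circuit of $M$ and a $2t$-element cocircuit of $M$, each containing $\{z\}\cup\bigcup_{i\in I}S_i$.
   Context: A matroid $M$ has the $(t,\ell)$-property if every $t$-element subset of $E(M)$ is contained in both an $\ell$-element circuit and an $\ell$-element cocircuit of $M$. A $t$-echidna of order $n$ of $M$ is a partition $(S_1,\dots,S_n)$ of a subset of $E(M)$ such that $|S_i|=2$ for all $i$ and $\bigcup_{i\in I} S_i$ is a circuit of $M$ for every $I\subseteq\{1,\dots,n\}$ with $|I|=t$. -}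

module Defs where

open import Data.Nat using (ℕ; zero; suc; _<_)
open import Data.Fin using (Fin)
open import Data.Fin.Subset
open import Data.Vec using (_∷_)
open import Data.Bool using (if_then_else_)
open import Data.Product using (Σ; ∃; _×_; _,_)
open import Relation.Binary.PropositionalEquality using (_≡_; _≢_)
open import Relation.Nullary using (¬_)
open import Level using (0ℓ; suc)

record Matroid (m : ℕ) : Set₁ where
  field
    Indep   : Subset m → Set
    I-empty : Indep ⊥
    I-down  : ∀ {X Y} → Indep Y → X ⊆ Y → Indep X
    I-aug   : ∀ {X Y} → Indep X → Indep Y → ∣ X ∣ < ∣ Y ∣ →
              ∃ λ e → e ∈ Y × e ∉ X × Indep (X ∪ ⁅ e ⁆)

IsCircuitFor : ∀ {m} → (Subset m → Set) → Subset m → Set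
IsCircuitFor Ind C = ¬ Ind C × (∀ X → X ⊆ C → X ≢ C → Ind X)

module _ {m : ℕ} (M : Matroid m) where
  open Matroid M

  IsBasis : Subset m → Set
  IsBasis B = Indep B × (∀ X → Indep X → B ⊆ X → X ≡ B)

  DualIndep : Subset m → Set
  DualIndep X = ∃ λ B → IsBasis B × (X ∩ B ≡ ⊥)

  IsCircuit : Subset m → Set
  IsCircuit = IsCircuitFor Indep

  IsCocircuit : Subset m → Set
  IsCocircuit = IsCircuitFor DualIndep

  HasProperty : ℕ → ℕ → Set
  HasProperty t ℓ = ∀ X → ∣ X ∣ ≡ t →
    (∃ λ C → IsCircuit C × ∣ C ∣ ≡ ℓ × X ⊆ C) ×
    (∃ λ D → IsCocircuit D × ∣ D ∣ ≡ ℓ × X ⊆ D)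

⋃[_]_ : ∀ {n m} → Subset n → (Fin n → Subset m) → Subset m
⋃[_]_ {zero}  I       S = ⊥
⋃[_]_ {suc n} (b ∷ I) S =
  (if b then S Fin.zero else ⊥) ∪ (⋃[ I ] (λ i → S (Fin.suc i)))
  where import Data.Fin as Fin

module _ {m : ℕ} (M : Matroid m) where
  IsEchidna : (t n : ℕ) → (Fin n → Subset m) → Set
  IsEchidna t n S =
    (∀ i → ∣ S i ∣ ≡ 2) ×
    (∀ i j → i ≢ j → S i ∩ S j ≡ ⊥) ×
    (∀ (I : Subset n) → ∣ I ∣ ≡ t → IsCircuit M (⋃[ I ] S))

module Submission where

-- Proof idea.  Call a set A saturated (with respect to the pairs S₁, …, Sₙ)
-- if every pair that meets A lies inside A.  Two facts drive the argument:
--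
-- * Orthogonality: a circuit and a cocircuit never meet in exactly one element.
-- * Saturation: if |A| + (t - 1) ≤ n and no union of t pairs meets A in
--   exactly one element, then A is saturated.  Indeed, if e ∈ Sᵢ ∩ A but
--   Sᵢ ⊄ A, then A meets at most |A| pairs, so t - 1 further pairs avoid A,
--   and together with Sᵢ they form a union of t pairs meeting A only in e.
--
-- Since the unions of t pairs are circuits, every 2t-element cocircuit is
-- saturated.  Applying the (t,2t)-property to one representative from each of
-- t pairs then shows that every union of t pairs is also a cocircuit, hence
-- every 2t-element circuit is saturated as well.  Finally the (t,2t)-property
-- applied to z together with one representative of each pair Sᵢ (i ∈ I) gives
-- a 2t-element circuit and cocircuit; both are saturated, so both contain
-- {z} ∪ ⋃_{i∈I} Sᵢ.

open import Defs
open import Data.Nat using (ℕ; zero; suc; _+_; _*_; _∸_; _≤_; _<_; z≤n; s≤s; s≤s⁻¹)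
open import Data.Nat.Properties
  using (≤-trans; ≤-reflexive; ≤⇒≯; ≮⇒≥; +-mono-≤; +-suc; +-identityʳ; *-suc; *-zeroʳ;
         m<m+n; m+[n∸m]≡n; m+n≤o⇒m≤o∸n; ∸-monoʳ-≤; +-∸-comm; *-identityˡ)
open import Data.Fin using (Fin; zero; suc; _≟_)
open import Data.Fin.Properties using (suc-injective)
open import Data.Fin.Subset
  using (Subset; inside; outside; _∈_; _∉_; _⊆_; _∪_; _∩_; _-_; ⁅_⁆; ⊥; ∁; ∣_∣; Nonempty; Empty)
open import Data.Fin.Subset.Properties
  using (_∈?_; nonempty?; Empty-unique; ∉⊥; ⊥⊆; ∣⊥∣≡0; x∈⁅x⁆; x∈⁅y⁆⇒x≡y; x≢y⇒x∉⁅y⁆; ∣⁅x⁆∣≡1;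
         ⊆-trans; ⊆-antisym; p⊆q⇒∣p∣≤∣q∣; p⊂q⇒∣p∣<∣q∣; ⊂-irref; out⊆; s⊆s; x∈∁p⇒x∉p; ∣∁p∣≡n∸∣p∣;
         p∩q⊆p; p∩q⊆q; x∈p∩q⁺; x∈p∩q⁻; p⊆p∪q; q⊆p∪q; x∈p∪q⁺; x∈p∪q⁻; ∪-comm; ∪-identityˡ;
         p─q⊆p; x∈p∧x≢y⇒x∈p-y; x∈p⇒p-x⊂p)
open import Data.Vec using ([]; _∷_; here; there)
open import Data.Product using (∃; _×_; _,_; proj₁; proj₂)
open import Data.Sum using (_⊎_; inj₁; inj₂; [_,_])
open import Function using (_∘_; id)
open import Relation.Nullary using (¬_; Dec; yes; no; contradiction)
open import Relation.Binary.PropositionalEquality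
  using (_≡_; _≢_; refl; sym; trans; cong; cong₂; subst; module ≡-Reasoning)

Disjoint : ∀ {n} → Subset n → Subset n → Set
Disjoint p q = ∀ {x} → x ∈ p → x ∉ q

Disjoint-tail : ∀ {n} {a b} {p q : Subset n} → Disjoint (a ∷ p) (b ∷ q) → Disjoint p q
Disjoint-tail disj x∈p x∈q = disj (there x∈p) (there x∈q)

∣p∪q∣≡∣p∣+∣q∣ : ∀ {n} (p q : Subset n) → Disjoint p q → ∣ p ∪ q ∣ ≡ ∣ p ∣ + ∣ q ∣
∣p∪q∣≡∣p∣+∣q∣ []            []            _    = refl
∣p∪q∣≡∣p∣+∣q∣ (inside  ∷ p) (inside  ∷ q) disj = contradiction here (disj here)
∣p∪q∣≡∣p∣+∣q∣ (inside  ∷ p) (outside ∷ q) disj = cong suc (∣p∪q∣≡∣p∣+∣q∣ p q (Disjoint-tail disj))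
∣p∪q∣≡∣p∣+∣q∣ (outside ∷ p) (inside  ∷ q) disj =
  trans (cong suc (∣p∪q∣≡∣p∣+∣q∣ p q (Disjoint-tail disj))) (sym (+-suc ∣ p ∣ ∣ q ∣))
∣p∪q∣≡∣p∣+∣q∣ (outside ∷ p) (outside ∷ q) disj = ∣p∪q∣≡∣p∣+∣q∣ p q (Disjoint-tail disj)

∣⁅x⁆∪p∣≡1+∣p∣ : ∀ {n} {x : Fin n} (p : Subset n) → x ∉ p → ∣ ⁅ x ⁆ ∪ p ∣ ≡ suc ∣ p ∣
∣⁅x⁆∪p∣≡1+∣p∣ {x = x} p x∉p =
  trans (∣p∪q∣≡∣p∣+∣q∣ ⁅ x ⁆ p λ y∈⁅x⁆ y∈p → x∉p (subst (_∈ p) (x∈⁅y⁆⇒x≡y x y∈⁅x⁆) y∈p))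
        (cong (_+ ∣ p ∣) (∣⁅x⁆∣≡1 x))

∪-least : ∀ {n} {p q r : Subset n} → p ⊆ r → q ⊆ r → p ∪ q ⊆ r
∪-least {p = p} {q} p⊆r q⊆r x∈p∪q = [ p⊆r , q⊆r ] (x∈p∪q⁻ p q x∈p∪q)

⁅x⁆⊆p : ∀ {n} {x : Fin n} {p : Subset n} → x ∈ p → ⁅ x ⁆ ⊆ p
⁅x⁆⊆p {x = x} {p} x∈p y∈⁅x⁆ = subst (_∈ p) (sym (x∈⁅y⁆⇒x≡y x y∈⁅x⁆)) x∈p

x∈p⇒1≤∣p∣ : ∀ {n} {x : Fin n} {p : Subset n} → x ∈ p → 1 ≤ ∣ p ∣
x∈p⇒1≤∣p∣ {x = x} x∈p = subst (_≤ _) (∣⁅x⁆∣≡1 x) (p⊆q⇒∣p∣≤∣q∣ (⁅x⁆⊆p x∈p))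

1≤∣p∣⇒Nonempty : ∀ {n} (p : Subset n) → 1 ≤ ∣ p ∣ → Nonempty p
1≤∣p∣⇒Nonempty {n} p 1≤∣p∣ with nonempty? p
... | yes nonempty = nonempty
... | no empty =
  contradiction (subst (1 ≤_) (∣⊥∣≡0 n) (subst (λ q → 1 ≤ ∣ q ∣) (Empty-unique empty) 1≤∣p∣)) λ ()

⊆∧∣≥∣⇒≡ : ∀ {n} {p q : Subset n} → p ⊆ q → ∣ q ∣ ≤ ∣ p ∣ → p ≡ q
⊆∧∣≥∣⇒≡ {p = p} {q} p⊆q ∣q∣≤∣p∣ = ⊆-antisym p⊆q q⊆p
  where
  q⊆p : q ⊆ p
  q⊆p {x} x∈q with x ∈? p
  ... | yes x∈p = x∈p
  ... | no  x∉p = contradiction (p⊂q⇒∣p∣<∣q∣ (p⊆q , x , x∈q , x∉p)) (≤⇒≯ ∣q∣≤∣p∣)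

p-x≢p : ∀ {n} {x : Fin n} {p : Subset n} → x ∈ p → p - x ≢ p
p-x≢p x∈p p-x≡p = ⊂-irref p-x≡p (x∈p⇒p-x⊂p x∈p)

pair-members : ∀ {n} {P : Subset n} {a b y : Fin n} →
  ∣ P ∣ ≡ 2 → a ∈ P → b ∈ P → a ≢ b → y ∈ P → y ≡ a ⊎ y ≡ b
pair-members {P = P} {a} {b} {y} ∣P∣≡2 a∈P b∈P a≢b y∈P =
  [ inj₁ ∘ x∈⁅y⁆⇒x≡y a , inj₂ ∘ x∈⁅y⁆⇒x≡y b ] (x∈p∪q⁻ ⁅ a ⁆ ⁅ b ⁆ (subst (y ∈_) (sym ab≡P) y∈P))
  where
  ∣ab∣≡2 : ∣ ⁅ a ⁆ ∪ ⁅ b ⁆ ∣ ≡ 2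
  ∣ab∣≡2 = trans (∣⁅x⁆∪p∣≡1+∣p∣ ⁅ b ⁆ (x≢y⇒x∉⁅y⁆ a≢b)) (cong suc (∣⁅x⁆∣≡1 b))

  ab≡P : ⁅ a ⁆ ∪ ⁅ b ⁆ ≡ P
  ab≡P = ⊆∧∣≥∣⇒≡ (∪-least (⁅x⁆⊆p a∈P) (⁅x⁆⊆p b∈P)) (≤-reflexive (trans ∣P∣≡2 (sym ∣ab∣≡2)))

choose : ∀ {n} (k : ℕ) (p : Subset n) → k ≤ ∣ p ∣ → ∃ λ q → q ⊆ p × ∣ q ∣ ≡ k
choose {n} zero p _ = ⊥ , ⊥⊆ , ∣⊥∣≡0 n
choose (suc k) (outside ∷ p) k<∣p∣ with choose (suc k) p k<∣p∣
... | q , q⊆p , ∣q∣≡k = outside ∷ q , out⊆ q⊆p , ∣q∣≡k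
choose (suc k) (inside  ∷ p) k<∣p∣ with choose k p (s≤s⁻¹ k<∣p∣)
... | q , q⊆p , ∣q∣≡k = inside ∷ q , s⊆s q⊆p , cong suc ∣q∣≡k

comprehension : ∀ {n} (P : Fin n → Set) → (∀ j → Dec (P j)) →
  ∃ λ F → (∀ {j} → j ∈ F → P j) × (∀ {j} → P j → j ∈ F)
comprehension {zero}  P P? = [] , (λ ()) , λ { {()} }
comprehension {suc n} P P? with comprehension (P ∘ suc) (P? ∘ suc) | P? zero
... | F , sound , complete | yes P0 =
  inside ∷ F , (λ { here → P0 ; (there j∈F) → sound j∈F }) ,
               (λ { {zero} _ → here ; {suc j} Pj → there (complete Pj) })
... | F , sound , complete | no ¬P0 =
  outside ∷ F , (λ { (there j∈F) → sound j∈F }) ,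
                (λ { {zero} P0 → contradiction P0 ¬P0 ; {suc j} Pj → there (complete Pj) })

MeetIn : ∀ {m} → Subset m → Subset m → Fin m → Set
MeetIn A B e = e ∈ A × e ∈ B × (∀ {x} → x ∈ A → x ∈ B → x ≡ e)

MeetIn-sym : ∀ {m} {A B : Subset m} {e} → MeetIn A B e → MeetIn B A e
MeetIn-sym (e∈A , e∈B , only-e) = e∈B , e∈A , λ x∈B x∈A → only-e x∈A x∈B

module _ {m : ℕ} where

  ∈⋃⁺ : ∀ {n} (I : Subset n) (T : Fin n → Subset m) {j x} → j ∈ I → x ∈ T j → x ∈ ⋃[ I ] T
  ∈⋃⁺ (inside ∷ I) T here        x∈T = x∈p∪q⁺ (inj₁ x∈T)
  ∈⋃⁺ (_      ∷ I) T (there j∈I) x∈T = x∈p∪q⁺ (inj₂ (∈⋃⁺ I (T ∘ suc) j∈I x∈T))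

  ∈⋃⁻ : ∀ {n} (I : Subset n) (T : Fin n → Subset m) {x} → x ∈ ⋃[ I ] T → ∃ λ j → j ∈ I × x ∈ T j
  ∈⋃⁻ []           T x∈⋃ = contradiction x∈⋃ ∉⊥
  ∈⋃⁻ (b ∷ I) T x∈⋃ with b | x∈p∪q⁻ _ (⋃[ I ] (T ∘ suc)) x∈⋃
  ... | inside  | inj₁ x∈T0 = zero , here , x∈T0
  ... | outside | inj₁ x∈⊥  = contradiction x∈⊥ ∉⊥
  ... | _       | inj₂ x∈⋃′ with ∈⋃⁻ I (T ∘ suc) x∈⋃′
  ...   | j , j∈I , x∈T = suc j , there j∈I , x∈T

  ⋃-least : ∀ {n} (I : Subset n) (T : Fin n → Subset m) {A} → (∀ {j} → j ∈ I → T j ⊆ A) → ⋃[ I ] T ⊆ A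
  ⋃-least I T T⊆A x∈⋃ with ∈⋃⁻ I T x∈⋃
  ... | j , j∈I , x∈T = T⊆A j∈I x∈T

PairwiseDisjoint : ∀ {n m} → (Fin n → Subset m) → Set
PairwiseDisjoint T = ∀ i j → i ≢ j → Disjoint (T i) (T j)

module _ {n m : ℕ} where

  ∣⋃-inside∣ : ∀ (I : Subset n) (T : Fin (suc n) → Subset m) → PairwiseDisjoint T →
    ∣ ⋃[ inside ∷ I ] T ∣ ≡ ∣ T zero ∣ + ∣ ⋃[ I ] (T ∘ suc) ∣
  ∣⋃-inside∣ I T pd = ∣p∪q∣≡∣p∣+∣q∣ (T zero) _ λ x∈T0 x∈⋃ →
    let (j , _ , x∈Tj) = ∈⋃⁻ I (T ∘ suc) x∈⋃ in pd zero (suc j) (λ ()) x∈T0 x∈Tj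

  ∣⋃-outside∣ : ∀ (I : Subset n) (T : Fin (suc n) → Subset m) →
    ∣ ⋃[ outside ∷ I ] T ∣ ≡ ∣ ⋃[ I ] (T ∘ suc) ∣
  ∣⋃-outside∣ I T = cong ∣_∣ (∪-identityˡ (⋃[ I ] (T ∘ suc)))

  PairwiseDisjoint-tail : ∀ {T : Fin (suc n) → Subset m} → PairwiseDisjoint T → PairwiseDisjoint (T ∘ suc)
  PairwiseDisjoint-tail pd i j i≢j = pd (suc i) (suc j) (i≢j ∘ suc-injective)

∣⋃∣≡k*∣I∣ : ∀ {n m} (I : Subset n) (T : Fin n → Subset m) {k} → PairwiseDisjoint T →
  (∀ {j} → j ∈ I → ∣ T j ∣ ≡ k) → ∣ ⋃[ I ] T ∣ ≡ k * ∣ I ∣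
∣⋃∣≡k*∣I∣ {m = m} []            T {k} _  _    = trans (∣⊥∣≡0 m) (sym (*-zeroʳ k))
∣⋃∣≡k*∣I∣         (inside  ∷ I) T {k} pd size = begin
  ∣ ⋃[ inside ∷ I ] T ∣              ≡⟨ ∣⋃-inside∣ I T pd ⟩
  ∣ T zero ∣ + ∣ ⋃[ I ] (T ∘ suc) ∣  ≡⟨ cong₂ _+_ (size here) rest ⟩
  k + k * ∣ I ∣                      ≡⟨ sym (*-suc k ∣ I ∣) ⟩
  k * suc ∣ I ∣                      ∎
  where
  open ≡-Reasoning
  rest : ∣ ⋃[ I ] (T ∘ suc) ∣ ≡ k * ∣ I ∣
  rest = ∣⋃∣≡k*∣I∣ I (T ∘ suc) (PairwiseDisjoint-tail pd) (size ∘ there)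
∣⋃∣≡k*∣I∣         (outside ∷ I) T     pd size =
  trans (∣⋃-outside∣ I T) (∣⋃∣≡k*∣I∣ I (T ∘ suc) (PairwiseDisjoint-tail pd) (size ∘ there))

∣I∣≤∣⋃∣ : ∀ {n m} (I : Subset n) (T : Fin n → Subset m) → PairwiseDisjoint T →
  (∀ {j} → j ∈ I → Nonempty (T j)) → ∣ I ∣ ≤ ∣ ⋃[ I ] T ∣
∣I∣≤∣⋃∣ []            T _  _        = z≤n
∣I∣≤∣⋃∣ (inside  ∷ I) T pd nonempty =
  subst (suc ∣ I ∣ ≤_) (sym (∣⋃-inside∣ I T pd))
    (+-mono-≤ (x∈p⇒1≤∣p∣ (proj₂ (nonempty here)))
              (∣I∣≤∣⋃∣ I (T ∘ suc) (PairwiseDisjoint-tail pd) (nonempty ∘ there)))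
∣I∣≤∣⋃∣ (outside ∷ I) T pd nonempty =
  subst (∣ I ∣ ≤_) (sym (∣⋃-outside∣ I T))
    (∣I∣≤∣⋃∣ I (T ∘ suc) (PairwiseDisjoint-tail pd) (nonempty ∘ there))

module MatroidFacts {m : ℕ} (M : Matroid m) where
  open Matroid M

  basis-maximum : ∀ {B X} → IsBasis M B → Indep X → ∣ X ∣ ≤ ∣ B ∣
  basis-maximum (indB , maximal) indX = ≮⇒≥ λ ∣B∣<∣X∣ →
    let (e , _ , e∉B , indB+e) = I-aug indB indX ∣B∣<∣X∣
    in e∉B (subst (e ∈_) (maximal _ indB+e (p⊆p∪q _)) (x∈p∪q⁺ (inj₂ (x∈⁅x⁆ e))))

  large-indep-is-basis : ∀ {B K} → IsBasis M B → Indep K → ∣ B ∣ ≤ ∣ K ∣ → IsBasis M K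
  large-indep-is-basis basisB indK ∣B∣≤∣K∣ =
    indK , λ X indX K⊆X → sym (⊆∧∣≥∣⇒≡ K⊆X (≤-trans (basis-maximum basisB indX) ∣B∣≤∣K∣))

  extend-by : ∀ {A Y} (k : ℕ) → Indep A → Indep Y → ∣ A ∣ + k ≡ ∣ Y ∣ →
    ∃ λ K → Indep K × A ⊆ K × K ⊆ A ∪ Y × ∣ Y ∣ ≤ ∣ K ∣
  extend-by {A} zero indA _ size =
    A , indA , id , p⊆p∪q _ , ≤-reflexive (trans (sym size) (+-identityʳ ∣ A ∣))
  extend-by {A} {Y} (suc k) indA indY size
    with I-aug indA indY (subst (∣ A ∣ <_) size (m<m+n ∣ A ∣ (s≤s z≤n)))
  ... | e , e∈Y , e∉A , indA+e with extend-by k indA+e indY size′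
    where
    size′ : ∣ A ∪ ⁅ e ⁆ ∣ + k ≡ ∣ Y ∣
    size′ = trans (cong (_+ k) (trans (cong ∣_∣ (∪-comm A ⁅ e ⁆)) (∣⁅x⁆∪p∣≡1+∣p∣ A e∉A)))
                  (trans (sym (+-suc ∣ A ∣ k)) size)
  ...   | K , indK , A+e⊆K , K⊆A+e∪Y , ∣Y∣≤∣K∣ =
    K , indK , A+e⊆K ∘ p⊆p∪q _ ,
    ⊆-trans K⊆A+e∪Y (∪-least (∪-least (p⊆p∪q Y) (⁅x⁆⊆p (q⊆p∪q A Y e∈Y))) (q⊆p∪q A Y)) ,
    ∣Y∣≤∣K∣

  -- If C ∩ D = {e},
  -- extend C - e inside (C - e) ∪ B to a basis K, where B is a basis avoiding
  -- D - e; then K avoids e (else C ⊆ K) and so avoids D, making D coindependent.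
  orthogonality : ∀ {C D e} → IsCircuit M C → IsCocircuit M D → ¬ MeetIn C D e
  orthogonality {C} {D} {e} (C-dep , C-min) (D-dep , D-min) (e∈C , e∈D , only-e)
    with D-min (D - e) (p─q⊆p D ⁅ e ⁆) (p-x≢p e∈D)
  ... | B , basisB , D-e∩B≡⊥
    with extend-by _ indC-e (proj₁ basisB) (m+[n∸m]≡n (basis-maximum basisB indC-e))
    where
    indC-e : Indep (C - e)
    indC-e = C-min (C - e) (p─q⊆p C ⁅ e ⁆) (p-x≢p e∈C)
  ... | K , indK , C-e⊆K , K⊆C-e∪B , ∣B∣≤∣K∣ =
    D-dep (K , large-indep-is-basis basisB indK ∣B∣≤∣K∣ , Empty-unique D∩K-empty)
    where
    e∉K : e ∉ K
    e∉K e∈K = C-dep (I-down indK C⊆K)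
      where
      C⊆K : C ⊆ K
      C⊆K {x} x∈C with x ≟ e
      ... | yes refl = e∈K
      ... | no  x≢e  = C-e⊆K (x∈p∧x≢y⇒x∈p-y x∈C x≢e)

    D∩K-empty : Empty (D ∩ K)
    D∩K-empty (x , x∈D∩K) with x∈p∩q⁻ D K x∈D∩K
    ... | x∈D , x∈K with x∈p∪q⁻ (C - e) B (K⊆C-e∪B x∈K)
    ...   | inj₁ x∈C-e = e∉K (subst (_∈ K) (only-e (p─q⊆p C ⁅ e ⁆ x∈C-e) x∈D) x∈K)
    ...   | inj₂ x∈B   = ∉⊥ (subst (x ∈_) D-e∩B≡⊥ (x∈p∩q⁺ (x∈p∧x≢y⇒x∈p-y x∈D x≢e , x∈B)))
      where
      x≢e : x ≢ e
      x≢e x≡e = e∉K (subst (_∈ K) x≡e x∈K)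

module Pairs {n m : ℕ} (S : Fin n → Subset m)
             (pair : ∀ i → ∣ S i ∣ ≡ 2) (disjoint : PairwiseDisjoint S) where

  Saturated : Subset m → Set
  Saturated A = ∀ {i e x} → e ∈ S i → e ∈ A → x ∈ S i → x ∈ A

  Avoids : Subset m → Subset n → Set
  Avoids A J = ∀ {j x} → j ∈ J → x ∈ S j → x ∉ A

  -- The pairs meet A in disjoint nonempty pieces, so at most |A| of them meet A.
  few-pairs-meet : ∀ {A : Subset m} (F : Subset n) → (∀ {j} → j ∈ F → Nonempty (S j ∩ A)) → ∣ F ∣ ≤ ∣ A ∣
  few-pairs-meet {A} F meets = ≤-trans
    (∣I∣≤∣⋃∣ F (λ j → S j ∩ A) (λ i j i≢j x∈i x∈j → disjoint i j i≢j (p∩q⊆p _ _ x∈i) (p∩q⊆p _ _ x∈j)) meets)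
    (p⊆q⇒∣p∣≤∣q∣ (⋃-least F (λ j → S j ∩ A) λ _ → p∩q⊆q _ _))

  avoiding-pairs : ∀ {A : Subset m} (k : ℕ) → k + ∣ A ∣ ≤ n → ∃ λ J → ∣ J ∣ ≡ k × Avoids A J
  avoiding-pairs {A} k room with comprehension (λ j → Nonempty (S j ∩ A)) (λ j → nonempty? (S j ∩ A))
  ... | F , meets , meeting-in-F with choose k (∁ F) k≤∣∁F∣
    where
    k≤∣∁F∣ : k ≤ ∣ ∁ F ∣
    k≤∣∁F∣ = subst (k ≤_) (sym (∣∁p∣≡n∸∣p∣ F))
               (≤-trans (m+n≤o⇒m≤o∸n k room) (∸-monoʳ-≤ n (few-pairs-meet F meets)))
  ... | J , J⊆∁F , ∣J∣≡k =
    J , ∣J∣≡k , λ j∈J x∈Sj x∈A → x∈∁p⇒x∉p (J⊆∁F j∈J) (meeting-in-F (_ , x∈p∩q⁺ (x∈Sj , x∈A)))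

  saturation : ∀ {A : Subset m} (t : ℕ) → 1 ≤ t → (t ∸ 1) + ∣ A ∣ ≤ n →
    (∀ I e → ∣ I ∣ ≡ t → ¬ MeetIn (⋃[ I ] S) A e) → Saturated A
  saturation {A} t 1≤t room no-single-meet {i} {e} {x} e∈Si e∈A x∈Si with x ∈? A
  ... | yes x∈A = x∈A
  ... | no  x∉A with avoiding-pairs (t ∸ 1) room
  ...   | J , ∣J∣≡t-1 , J-avoids =
    contradiction (∈⋃⁺ I S i∈I e∈Si , e∈A , λ {y} → only-e {y}) (no-single-meet I e ∣I∣≡t)
    where
    I : Subset n
    I = ⁅ i ⁆ ∪ J

    i∈I : i ∈ I
    i∈I = x∈p∪q⁺ (inj₁ (x∈⁅x⁆ i))

    ∣I∣≡t : ∣ I ∣ ≡ t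
    ∣I∣≡t = trans (∣⁅x⁆∪p∣≡1+∣p∣ J λ i∈J → J-avoids i∈J e∈Si e∈A)
                  (trans (cong suc ∣J∣≡t-1) (m+[n∸m]≡n 1≤t))

    e≢x : e ≢ x
    e≢x e≡x = x∉A (subst (_∈ A) e≡x e∈A)

    only-e : ∀ {y} → y ∈ ⋃[ I ] S → y ∈ A → y ≡ e
    only-e {y} y∈⋃ y∈A with ∈⋃⁻ I S y∈⋃
    ... | j , j∈I , y∈Sj with x∈p∪q⁻ ⁅ i ⁆ J j∈I
    ...   | inj₂ j∈J = contradiction y∈A (J-avoids j∈J y∈Sj)
    ...   | inj₁ j∈⁅i⁆
      with pair-members (pair i) e∈Si x∈Si e≢x (subst (λ k → y ∈ S k) (x∈⁅y⁆⇒x≡y i j∈⁅i⁆) y∈Sj)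
    ...     | inj₁ y≡e = y≡e
    ...     | inj₂ y≡x = contradiction (subst (_∈ A) y≡x y∈A) x∉A

  representative : ∀ i → ∃ λ x → x ∈ S i
  representative i = 1≤∣p∣⇒Nonempty (S i) (subst (1 ≤_) (sym (pair i)) (s≤s z≤n))

  transversal : Subset n → Subset m
  transversal I = ⋃[ I ] (λ i → ⁅ proj₁ (representative i) ⁆)

  ∣transversal∣ : ∀ I → ∣ transversal I ∣ ≡ ∣ I ∣
  ∣transversal∣ I = trans (∣⋃∣≡k*∣I∣ I _ distinct (λ {j} _ → ∣⁅x⁆∣≡1 (proj₁ (representative j)))) (*-identityˡ ∣ I ∣)
    where
    distinct : PairwiseDisjoint (λ i → ⁅ proj₁ (representative i) ⁆)
    distinct i j i≢j x∈i x∈j =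
      disjoint i j i≢j (⁅x⁆⊆p (proj₂ (representative i)) x∈i) (⁅x⁆⊆p (proj₂ (representative j)) x∈j)

  transversal⊆⋃ : ∀ I → transversal I ⊆ ⋃[ I ] S
  transversal⊆⋃ I = ⋃-least I _ λ {j} j∈I → ⁅x⁆⊆p (∈⋃⁺ I S j∈I (proj₂ (representative j)))

  saturated⇒⋃⊆ : ∀ {A} I → Saturated A → transversal I ⊆ A → ⋃[ I ] S ⊆ A
  saturated⇒⋃⊆ I sat X⊆A = ⋃-least I S λ {j} j∈I x∈Sj →
    sat (proj₂ (representative j)) (X⊆A (∈⋃⁺ I _ j∈I (x∈⁅x⁆ _))) x∈Sj

  ∣⋃∣≡2*∣I∣ : ∀ I → ∣ ⋃[ I ] S ∣ ≡ 2 * ∣ I ∣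
  ∣⋃∣≡2*∣I∣ I = ∣⋃∣≡k*∣I∣ I S disjoint (λ {j} _ → pair j)

module Echidna {m : ℕ} (M : Matroid m) (t : ℕ) (1≤t : 1 ≤ t) {n : ℕ} (S : Fin n → Subset m)
               (echidna : IsEchidna M t n S) (long : 3 * t ∸ 1 ≤ n)
               (property : HasProperty M t (2 * t)) where
  open MatroidFacts M

  disjoint : PairwiseDisjoint S
  disjoint i j i≢j {x} x∈Si x∈Sj =
    ∉⊥ (subst (x ∈_) (proj₁ (proj₂ echidna) i j i≢j) (x∈p∩q⁺ (x∈Si , x∈Sj)))

  open Pairs S (proj₁ echidna) disjoint public

  room : ∀ (A : Subset m) → ∣ A ∣ ≡ 2 * t → (t ∸ 1) + ∣ A ∣ ≤ n
  room _ ∣A∣≡2t = subst (_≤ n) (trans (+-∸-comm (2 * t) 1≤t) (cong ((t ∸ 1) +_) (sym ∣A∣≡2t))) long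

  -- A 2t-element cocircuit is saturated, by orthogonality with the echidna's circuits.
  cocircuit-saturated : ∀ {D} → IsCocircuit M D → ∣ D ∣ ≡ 2 * t → Saturated D
  cocircuit-saturated {D} D-cocircuit ∣D∣≡2t =
    saturation t 1≤t (room D ∣D∣≡2t) λ I e ∣I∣≡t → orthogonality (proj₂ (proj₂ echidna) I ∣I∣≡t) D-cocircuit

  -- Every union of t pairs is a cocircuit: the 2t-element cocircuit through a
  -- transversal of the t pairs is saturated, so it contains them and equals their union.
  union-cocircuit : ∀ I → ∣ I ∣ ≡ t → IsCocircuit M (⋃[ I ] S)
  union-cocircuit I ∣I∣≡t
    with proj₂ (property (transversal I) (trans (∣transversal∣ I) ∣I∣≡t))
  ... | D , D-cocircuit , ∣D∣≡2t , X⊆D = subst (IsCocircuit M) (sym ⋃≡D) D-cocircuit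
    where
    ⋃≡D : ⋃[ I ] S ≡ D
    ⋃≡D = ⊆∧∣≥∣⇒≡ (saturated⇒⋃⊆ I (cocircuit-saturated D-cocircuit ∣D∣≡2t) X⊆D)
            (≤-reflexive (trans ∣D∣≡2t (trans (cong (2 *_) (sym ∣I∣≡t)) (sym (∣⋃∣≡2*∣I∣ I)))))

  -- A 2t-element circuit is saturated, by orthogonality with the unions of t pairs.
  circuit-saturated : ∀ {C} → IsCircuit M C → ∣ C ∣ ≡ 2 * t → Saturated C
  circuit-saturated {C} C-circuit ∣C∣≡2t =
    saturation t 1≤t (room C ∣C∣≡2t) λ I e ∣I∣≡t meet →
      orthogonality C-circuit (union-cocircuit I ∣I∣≡t) (MeetIn-sym meet)

  saturated⇒target⊆ : ∀ {A} I z → Saturated A → ⁅ z ⁆ ∪ transversal I ⊆ A → ⁅ z ⁆ ∪ ⋃[ I ] S ⊆ A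
  saturated⇒target⊆ I z sat X⊆A =
    ∪-least (X⊆A ∘ p⊆p∪q _) (saturated⇒⋃⊆ I sat (X⊆A ∘ q⊆p∪q ⁅ z ⁆ _))

  ∣⁅z⁆∪transversal∣ : ∀ I z → z ∉ ⋃[ I ] S → ∣ ⁅ z ⁆ ∪ transversal I ∣ ≡ suc ∣ I ∣
  ∣⁅z⁆∪transversal∣ I z z∉⋃ =
    trans (∣⁅x⁆∪p∣≡1+∣p∣ (transversal I) (z∉⋃ ∘ transversal⊆⋃ I)) (cong suc (∣transversal∣ I))

lemma4p4 : ∀ {m : ℕ} (M : Matroid m) (t : ℕ) → 1 ≤ t → HasProperty M t (2 * t) →
    (n : ℕ) (S : Fin n → Subset m) → IsEchidna M t n S → 3 * t ∸ 1 ≤ n →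
    (I : Subset n) → ∣ I ∣ ≡ t ∸ 1 → (z : Fin m) → z ∉ ⋃[ I ] S →
    (∃ λ C → IsCircuit M C × ∣ C ∣ ≡ 2 * t × (⁅ z ⁆ ∪ ⋃[ I ] S) ⊆ C) ×
    (∃ λ D → IsCocircuit M D × ∣ D ∣ ≡ 2 * t × (⁅ z ⁆ ∪ ⋃[ I ] S) ⊆ D)
lemma4p4 {m} M t 1≤t property n S echidna long I ∣I∣≡t-1 z z∉⋃ =
  let ((C , C-circuit , ∣C∣≡2t , X⊆C) , (D , D-cocircuit , ∣D∣≡2t , X⊆D)) = property X ∣X∣≡t
  in (C , C-circuit , ∣C∣≡2t , saturated⇒target⊆ I z (circuit-saturated C-circuit ∣C∣≡2t) X⊆C) ,
     (D , D-cocircuit , ∣D∣≡2t , saturated⇒target⊆ I z (cocircuit-saturated D-cocircuit ∣D∣≡2t) X⊆D)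
  where
  open Echidna M t 1≤t S echidna long property

  X : Subset m
  X = ⁅ z ⁆ ∪ transversal I

  ∣X∣≡t : ∣ X ∣ ≡ t
  ∣X∣≡t = trans (∣⁅z⁆∪transversal∣ I z z∉⋃) (trans (cong suc ∣I∣≡t-1) (m+[n∸m]≡n 1≤t))
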